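{- Let $\mathbf{F}_q$ be a finite field with $q\equiv 1\pmod 4$, let $d=(q-1)/4$, and let $g$ be a generator of the multiplicative group $\mathbf{F}_q^*$. For an integer $i$ with $0\le i\le d-1$ define \[a_0=\frac{g^{2(4i+2)}+1}{2g^{4i+2}},\qquad a_1=\frac{(g^d+1)(g^{2(4i+2)}-1)}{4g^{4i+d+2}},\qquad a_2=g^d a_1 .\] Then the polynomial $f(x)=a_2x^{3d+1}+a_1x^{d+1}+a_0x\in\mathbf{F}_q[x]$ induces an involution of $\mathbf{F}_q$ (i.e. $f(f(x))=x$ for all $x\in\mathbf{F}_q$, so $f$ is a permutation of $\mathbf{F}_q$ equal to its own inverse), and $0$ is the only element $x\in\mathbf{F}_q$ with $f(x)=x$.
   Context: A polynomial $f\in\mathbf{F}_q[x]$ is regarded as the function $x\mapsto f(x)$ on $\mathbf{F}_q$. An involution of $\mathbf{F}_q$ is a map $f:\mathbf{F}_q\to\mathbf{F}_q$ with $f\circ f=\mathrm{id}$. A fixed point of $f$ is an $x\in\mathbf{F}_q$ with $f(x)=x$. -}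

module Defs where

open import Level using (Level; suc; _⊔_)
open import Data.Nat using (ℕ)
import Data.Nat as N
open import Data.Fin using (Fin)
open import Data.Product using (∃; _×_)
open import Relation.Binary.PropositionalEquality using (_≡_)
open import Relation.Nullary using (¬_; Dec)
open import Algebra.Bundles using (CommutativeRing; Semiring)
import Algebra.Definitions.RawSemiring as RawSemiringDefs

record FiniteField (c ℓ : Level) (q : ℕ) : Set (suc (c ⊔ ℓ)) where
  field
    commRing : CommutativeRing c ℓ
  open CommutativeRing commRing public
  open RawSemiringDefs (Semiring.rawSemiring (CommutativeRing.semiring commRing)) public using (_^_)
  field
    _≟_      : ∀ x y → Dec (x ≈ y)
    0≉1      : ¬ (0# ≈ 1#)
    _⁻¹      : Carrier → Carrier
    inverseʳ : ∀ x → ¬ (x ≈ 0#) → x * (x ⁻¹) ≈ 1#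
    enum     : Fin q → Carrier
    enum-injective  : ∀ i j → enum i ≈ enum j → i ≡ j
    enum-surjective : ∀ x → ∃ λ i → enum i ≈ x

module _ {c ℓ q} (F : FiniteField c ℓ q) where
  open FiniteField F

  IsGenerator : Carrier → Set (c ⊔ ℓ)
  IsGenerator g = ¬ (g ≈ 0#) × (∀ x → ¬ (x ≈ 0#) → ∃ λ k → g ^ k ≈ x)

  -- division a / b := a * b⁻¹ (only used with nonzero b)
  _÷_ : Carrier → Carrier → Carrier
  a ÷ b = a * (b ⁻¹)

  two four : Carrier
  two  = 1# + 1#
  four = two + two

  dOf : ℕ
  dOf = (q N.∸ 1) N./ 4

  a₀ : Carrier → ℕ → Carrier
  a₀ g i = (g ^ (2 N.* (4 N.* i N.+ 2)) + 1#) ÷ (two * g ^ (4 N.* i N.+ 2))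

  a₁ : Carrier → ℕ → Carrier
  a₁ g i = ((g ^ dOf + 1#) * (g ^ (2 N.* (4 N.* i N.+ 2)) - 1#))
           ÷ (four * g ^ (4 N.* i N.+ dOf N.+ 2))

  a₂ : Carrier → ℕ → Carrier
  a₂ g i = g ^ dOf * a₁ g i

  invPoly : Carrier → ℕ → Carrier → Carrier
  invPoly g i x = a₂ g i * x ^ (3 N.* dOf N.+ 1) + a₁ g i * x ^ (dOf N.+ 1) + a₀ g i * x

-- For x ≠ 0 put u = x^d. Then u is a power of ω = g^d, and ω² = -1, so u ∈ {1, ω, -1, -ω},
-- and f(x) = c(u)·x with c(u) = a₁ω u³ + a₁u + a₀. The coefficients are chosen so that
-- c(1) = c(ω) = h and c(-1) = c(-ω) = h⁻¹ for h = g^(4i+2).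
-- As h^d = ω^(4i+2) = -1, multiplying x by h or h⁻¹ negates u, so f swaps the two halves
-- of the fourth roots of unity and f(f(x)) = h⁻¹h x = x. A nonzero fixed point would force
-- h = 1, impossible since 0 < 4i + 2 < q - 1.
{-# OPTIONS --safe #-}
module Submission where

open import Defs
open import Level using (Level)
open import Data.Nat using (ℕ; _%_; _∸_; _/_; _<_)
open import Data.Product using (_×_)
open import Relation.Binary.PropositionalEquality using (_≡_)

import Data.Nat as N
import Data.Nat.Properties as ℕ
open import Data.Nat.DivMod using (m≡m%n+[m/n]*n; m%n<n; m*n/n≡m)
open import Algebra.Properties.CommutativeSemigroup ℕ.+-commutativeSemigroup using (xy∙z≈xz∙y)
open import Data.Fin using (Fin; toℕ; fromℕ<; punchOut)
import Data.Fin as Fin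
open import Data.Fin.Properties using (pigeonhole; injective⇒≤; punchOut-injective; toℕ-fromℕ<; toℕ<n; suc-injective)
open import Data.Product using (_,_; proj₁; proj₂; ∃₂)
open import Data.Sum using (_⊎_; inj₁; inj₂)
open import Relation.Nullary using (¬_; Dec; yes; no; contradiction)
import Relation.Binary.PropositionalEquality as ≡

[1+n]%4≡1⇒n≡n/4*4 : ∀ n → N.suc n % 4 ≡ 1 → n ≡ n / 4 N.* 4
[1+n]%4≡1⇒n≡n/4*4 n [1+n]%4≡1 = ≡.trans n≡s*4 (≡.cong (N._* 4) (≡.sym n/4≡s))
  where
  s : ℕ
  s = N.suc n / 4
  n≡s*4 : n ≡ s N.* 4
  n≡s*4 = ℕ.suc-injective (≡.trans (m≡m%n+[m/n]*n (N.suc n) 4) (≡.cong (N._+ s N.* 4) [1+n]%4≡1))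
  n/4≡s : n / 4 ≡ s
  n/4≡s = ≡.trans (≡.cong (_/ 4) n≡s*4) (m*n/n≡m s 4)

4i+2<d*4 : ∀ {i d} → i < d → 4 N.* i N.+ 2 < d N.* 4
4i+2<d*4 {i} {d} i<d = begin-strict
  4 N.* i N.+ 2    <⟨ ℕ.+-monoʳ-< (4 N.* i) (N.s<s (N.s<s N.z<s)) ⟩
  4 N.* i N.+ 4    ≡⟨ ℕ.+-comm (4 N.* i) 4 ⟩
  4 N.+ 4 N.* i    ≡⟨ ℕ.*-suc 4 i ⟨
  4 N.* N.suc i    ≤⟨ ℕ.*-monoʳ-≤ 4 i<d ⟩
  4 N.* d          ≡⟨ ℕ.*-comm 4 d ⟩
  d N.* 4          ∎
  where open ℕ.≤-Reasoning

module FieldProperties {c ℓ q} (F : FiniteField c ℓ q) where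
  open FiniteField F
  open import Relation.Binary.Reasoning.Setoid setoid
  open import Algebra.Properties.Ring ring using (-1*x≈-x; -‿involutive)
  open import Algebra.Properties.Group +-group using (x∙y⁻¹≈ε⇒x≈y; inverseʳ-unique)
  open import Algebra.Properties.Semiring.Exp semiring using (^-assocʳ; ^-congʳ)
  open import Algebra.Solver.Ring.NaturalCoefficients.Default commutativeSemiring
    using (solve; _:=_; _:+_; _:*_; con)

  *-cancelʳ-≉0 : ∀ {x y} z → ¬ (z ≈ 0#) → x * z ≈ y * z → x ≈ y
  *-cancelʳ-≉0 {x} {y} z z≉0 xz≈yz = begin
    x                ≈⟨ sym (*-identityʳ x) ⟩
    x * 1#           ≈⟨ *-congˡ (sym (inverseʳ z z≉0)) ⟩
    x * (z * z ⁻¹)   ≈⟨ sym (*-assoc x z (z ⁻¹)) ⟩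
    (x * z) * z ⁻¹   ≈⟨ *-congʳ xz≈yz ⟩
    (y * z) * z ⁻¹   ≈⟨ *-assoc y z (z ⁻¹) ⟩
    y * (z * z ⁻¹)   ≈⟨ *-congˡ (inverseʳ z z≉0) ⟩
    y * 1#           ≈⟨ *-identityʳ y ⟩
    y                ∎

  *-≉0 : ∀ {x y} → ¬ (x ≈ 0#) → ¬ (y ≈ 0#) → ¬ (x * y ≈ 0#)
  *-≉0 {x} {y} x≉0 y≉0 xy≈0 = x≉0 (*-cancelʳ-≉0 y y≉0 (trans xy≈0 (sym (zeroˡ y))))

  ^-≉0 : ∀ {x} → ¬ (x ≈ 0#) → ∀ n → ¬ (x ^ n ≈ 0#)
  ^-≉0 x≉0 N.zero      = λ 1≈0 → 0≉1 (sym 1≈0)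
  ^-≉0 x≉0 (N.suc n)   = *-≉0 x≉0 (^-≉0 x≉0 n)

  ÷-*-cancel : ∀ a {b} → ¬ (b ≈ 0#) → _÷_ F a b * b ≈ a
  ÷-*-cancel a {b} b≉0 = begin
    (a * b ⁻¹) * b   ≈⟨ *-assoc a (b ⁻¹) b ⟩
    a * (b ⁻¹ * b)   ≈⟨ *-congˡ (trans (*-comm (b ⁻¹) b) (inverseʳ b b≉0)) ⟩
    a * 1#           ≈⟨ *-identityʳ a ⟩
    a                ∎

  1^n≈1 : ∀ n → 1# ^ n ≈ 1#
  1^n≈1 N.zero    = refl
  1^n≈1 (N.suc n) = trans (*-identityˡ _) (1^n≈1 n)

  ^-comm-^ : ∀ x m n → (x ^ m) ^ n ≈ (x ^ n) ^ m
  ^-comm-^ x m n = begin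
    (x ^ m) ^ n   ≈⟨ ^-assocʳ x m n ⟩
    x ^ (m N.* n) ≈⟨ ^-congʳ x (ℕ.*-comm m n) ⟩
    x ^ (n N.* m) ≈⟨ sym (^-assocʳ x n m) ⟩
    (x ^ n) ^ m   ∎

  x*y≈y⇒x≈1 : ∀ {x y} → ¬ (y ≈ 0#) → x * y ≈ y → x ≈ 1#
  x*y≈y⇒x≈1 {x} {y} y≉0 xy≈y = *-cancelʳ-≉0 y y≉0 (trans xy≈y (sym (*-identityˡ y)))

  x*y≈1⇒x*[y*z]≈z : ∀ {x y} → x * y ≈ 1# → ∀ z → x * (y * z) ≈ z
  x*y≈1⇒x*[y*z]≈z {x} {y} xy≈1 z = trans (sym (*-assoc x y z)) (trans (*-congʳ xy≈1) (*-identityˡ z))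

  -x≈-1*x : ∀ x → - x ≈ - 1# * x
  -x≈-1*x x = sym (-1*x≈-x x)

  -1*-1≈1 : - 1# * - 1# ≈ 1#
  -1*-1≈1 = trans (-1*x≈-x (- 1#)) (-‿involutive 1#)

  x*x≈1⇒x≈-1 : ∀ {u} → u * u ≈ 1# → ¬ (u ≈ 1#) → u ≈ - 1#
  x*x≈1⇒x≈-1 {u} u*u≈1 u≉1 = inverseʳ-unique 1# u 1+u≈0
    where
    u-1≉0 : ¬ (u - 1# ≈ 0#)
    u-1≉0 u-1≈0 = u≉1 (x∙y⁻¹≈ε⇒x≈y u 1# u-1≈0)
    1+u≈0 : 1# + u ≈ 0#
    1+u≈0 = *-cancelʳ-≉0 (u - 1#) u-1≉0 (begin
      (1# + u) * (u - 1#)         ≈⟨ solve 2 (λ u m → (con 1 :+ u) :* (u :+ m) := u :* u :+ (u :* (con 1 :+ m) :+ m)) refl u (- 1#) ⟩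
      u * u + (u * (1# - 1#) - 1#) ≈⟨ +-cong u*u≈1 (+-congʳ (trans (*-congˡ (-‿inverseʳ 1#)) (zeroʳ u))) ⟩
      1# + (0# - 1#)              ≈⟨ +-congˡ (+-identityˡ (- 1#)) ⟩
      1# - 1#                     ≈⟨ -‿inverseʳ 1# ⟩
      0#                          ≈⟨ sym (zeroˡ _) ⟩
      0# * (u - 1#)               ∎)

  -1≉1⇒two≉0 : ¬ (- 1# ≈ 1#) → ¬ (two F ≈ 0#)
  -1≉1⇒two≉0 -1≉1 two≈0 = -1≉1 (sym (inverseʳ-unique 1# 1# two≈0))

  two≉0⇒four≉0 : ¬ (two F ≈ 0#) → ¬ (four F ≈ 0#)
  two≉0⇒four≉0 two≉0 four≈0 = *-≉0 two≉0 two≉0 (trans two*two≈four four≈0)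
    where
    two*two≈four : two F * two F ≈ four F
    two*two≈four = solve 0 ((con 1 :+ con 1) :* (con 1 :+ con 1) := (con 1 :+ con 1) :+ (con 1 :+ con 1)) refl

module FourthRoots {c ℓ q} (F : FiniteField c ℓ q) (ω : FiniteField.Carrier F) where
  open FiniteField F
  open FieldProperties F
  open import Relation.Binary.Reasoning.Setoid setoid
  open import Algebra.Properties.Ring ring using (-‿involutive; -1*x≈-x; -‿distribʳ-*)
  open import Algebra.Properties.Semiring.Exp semiring using (^-homo-*; ^-assocʳ; ^-congˡ)
  open import Algebra.Properties.CommutativeSemiring.Exp commutativeSemiring using (^-distrib-*)
  open import Algebra.Solver.Ring.NaturalCoefficients.Default commutativeSemiring
    using (solve; _:=_; _:+_; _:*_; con)

  Root⁺ Root⁻ FourthRoot : Carrier → Set ℓ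
  Root⁺ u = u ≈ 1# ⊎ u ≈ ω
  Root⁻ u = u ≈ - 1# ⊎ u ≈ - ω
  FourthRoot u = Root⁺ u ⊎ Root⁻ u

  Root⁺-resp : ∀ {u v} → u ≈ v → Root⁺ u → Root⁺ v
  Root⁺-resp u≈v (inj₁ u≈1) = inj₁ (trans (sym u≈v) u≈1)
  Root⁺-resp u≈v (inj₂ u≈ω) = inj₂ (trans (sym u≈v) u≈ω)

  Root⁻-resp : ∀ {u v} → u ≈ v → Root⁻ u → Root⁻ v
  Root⁻-resp u≈v (inj₁ u≈-1) = inj₁ (trans (sym u≈v) u≈-1)
  Root⁻-resp u≈v (inj₂ u≈-ω) = inj₂ (trans (sym u≈v) u≈-ω)

  FourthRoot-resp : ∀ {u v} → u ≈ v → FourthRoot u → FourthRoot v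
  FourthRoot-resp u≈v (inj₁ r) = inj₁ (Root⁺-resp u≈v r)
  FourthRoot-resp u≈v (inj₂ r) = inj₂ (Root⁻-resp u≈v r)

  -‿Root⁺ : ∀ {u} → Root⁺ u → Root⁻ (- u)
  -‿Root⁺ (inj₁ u≈1) = inj₁ (-‿cong u≈1)
  -‿Root⁺ (inj₂ u≈ω) = inj₂ (-‿cong u≈ω)

  -‿Root⁻ : ∀ {u} → Root⁻ u → Root⁺ (- u)
  -‿Root⁻ (inj₁ u≈-1) = inj₁ (trans (-‿cong u≈-1) (-‿involutive 1#))
  -‿Root⁻ (inj₂ u≈-ω) = inj₂ (trans (-‿cong u≈-ω) (-‿involutive ω))

  cubic : Carrier → Carrier → Carrier → Carrier
  cubic a b u = (ω * a) * (u * (u * u)) + a * u + b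

  cubic-cong : ∀ a b {u v} → u ≈ v → cubic a b u ≈ cubic a b v
  cubic-cong a b u≈v = +-congʳ (+-cong (*-congˡ (*-cong u≈v (*-cong u≈v u≈v))) (*-congˡ u≈v))

  module _ (ω²≈-1 : ω * ω ≈ - 1#) where

    ω≉0 : ¬ (ω ≈ 0#)
    ω≉0 ω≈0 = 0≉1 (sym (begin
      1#                 ≈⟨ sym -1*-1≈1 ⟩
      - 1# * - 1#        ≈⟨ *-congʳ (sym ω²≈-1) ⟩
      (ω * ω) * - 1#     ≈⟨ *-congʳ (*-congʳ ω≈0) ⟩
      (0# * ω) * - 1#    ≈⟨ trans (*-congʳ (zeroˡ ω)) (zeroˡ (- 1#)) ⟩
      0#                 ∎))

    ω^4≈1 : ω ^ 4 ≈ 1#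
    ω^4≈1 = begin
      ω ^ 4                ≈⟨ solve 1 (λ w → w :* (w :* (w :* (w :* con 1))) := (w :* w) :* (w :* w)) refl ω ⟩
      (ω * ω) * (ω * ω)    ≈⟨ *-cong ω²≈-1 ω²≈-1 ⟩
      - 1# * - 1#          ≈⟨ -1*-1≈1 ⟩
      1#                   ∎

    ω^[4j+2]≈-1 : ∀ j → ω ^ (4 N.* j N.+ 2) ≈ - 1#
    ω^[4j+2]≈-1 j = begin
      ω ^ (4 N.* j N.+ 2)      ≈⟨ ^-homo-* ω (4 N.* j) 2 ⟩
      ω ^ (4 N.* j) * ω ^ 2    ≈⟨ *-cong (sym (^-assocʳ ω 4 j)) (*-congˡ (*-identityʳ ω)) ⟩
      (ω ^ 4) ^ j * (ω * ω)    ≈⟨ *-cong (trans (^-congˡ j ω^4≈1) (1^n≈1 j)) ω²≈-1 ⟩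
      1# * - 1#                ≈⟨ *-identityˡ (- 1#) ⟩
      - 1#                     ∎

    ω*-FourthRoot : ∀ {u} → FourthRoot u → FourthRoot (ω * u)
    ω*-FourthRoot (inj₁ (inj₁ u≈1))  = inj₁ (inj₂ (trans (*-congˡ u≈1) (*-identityʳ ω)))
    ω*-FourthRoot (inj₁ (inj₂ u≈ω))  = inj₂ (inj₁ (trans (*-congˡ u≈ω) ω²≈-1))
    ω*-FourthRoot (inj₂ (inj₁ u≈-1)) = inj₂ (inj₂ (begin
      ω * _        ≈⟨ *-congˡ u≈-1 ⟩
      ω * - 1#     ≈⟨ *-comm ω (- 1#) ⟩
      - 1# * ω     ≈⟨ -1*x≈-x ω ⟩
      - ω          ∎))
    ω*-FourthRoot (inj₂ (inj₂ u≈-ω)) = inj₁ (inj₁ (begin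
      ω * _        ≈⟨ *-congˡ u≈-ω ⟩
      ω * - ω      ≈⟨ sym (-‿distribʳ-* ω ω) ⟩
      - (ω * ω)    ≈⟨ -‿cong ω²≈-1 ⟩
      - - 1#       ≈⟨ -‿involutive 1# ⟩
      1#           ∎))

    ω^-FourthRoot : ∀ k → FourthRoot (ω ^ k)
    ω^-FourthRoot N.zero    = inj₁ (inj₁ refl)
    ω^-FourthRoot (N.suc k) = ω*-FourthRoot (ω^-FourthRoot k)

    cubic-Root⁺ : ∀ a b {u} → Root⁺ u → cubic a b u ≈ b + a * (1# + ω)
    cubic-Root⁺ a b (inj₁ u≈1) = begin
      cubic a b _                 ≈⟨ cubic-cong a b u≈1 ⟩
      cubic a b 1#                ≈⟨ solve 3 (λ w a b → (w :* a) :* (con 1 :* (con 1 :* con 1)) :+ a :* con 1 :+ b := b :+ a :* (con 1 :+ w)) refl ω a b ⟩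
      b + a * (1# + ω)            ∎
    cubic-Root⁺ a b (inj₂ u≈ω) = begin
      cubic a b _                 ≈⟨ cubic-cong a b u≈ω ⟩
      cubic a b ω                 ≈⟨ solve 3 (λ w a b → (w :* a) :* (w :* (w :* w)) :+ a :* w :+ b := a :* (w :* (w :* (w :* (w :* con 1)))) :+ a :* w :+ b) refl ω a b ⟩
      a * ω ^ 4 + a * ω + b       ≈⟨ +-congʳ (+-congʳ (*-congˡ ω^4≈1)) ⟩
      a * 1# + a * ω + b          ≈⟨ solve 3 (λ w a b → a :* con 1 :+ a :* w :+ b := b :+ a :* (con 1 :+ w)) refl ω a b ⟩
      b + a * (1# + ω)            ∎

    cubic-Root⁻ : ∀ a b {u} → Root⁻ u → cubic a b u ≈ b - a * (1# + ω)
    cubic-Root⁻ a b (inj₁ u≈-1) = begin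
      cubic a b _                      ≈⟨ cubic-cong a b u≈-1 ⟩
      cubic a b (- 1#)                 ≈⟨ solve 4 (λ w a b m → (w :* a) :* (m :* (m :* m)) :+ a :* m :+ b := (m :* m) :* (m :* (w :* a)) :+ a :* m :+ b) refl ω a b (- 1#) ⟩
      (- 1# * - 1#) * (- 1# * (ω * a)) + a * - 1# + b
                                       ≈⟨ +-congʳ (+-congʳ (*-congʳ -1*-1≈1)) ⟩
      1# * (- 1# * (ω * a)) + a * - 1# + b
                                       ≈⟨ solve 4 (λ w a b m → con 1 :* (m :* (w :* a)) :+ a :* m :+ b := b :+ m :* (a :* (con 1 :+ w))) refl ω a b (- 1#) ⟩
      b + - 1# * (a * (1# + ω))        ≈⟨ +-congˡ (-1*x≈-x _) ⟩
      b - a * (1# + ω)                 ∎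
    cubic-Root⁻ a b (inj₂ u≈-ω) = begin
      cubic a b _                      ≈⟨ cubic-cong a b (trans u≈-ω (-x≈-1*x ω)) ⟩
      cubic a b (- 1# * ω)             ≈⟨ solve 4 (λ w a b m → (w :* a) :* ((m :* w) :* ((m :* w) :* (m :* w))) :+ a :* (m :* w) :+ b := (m :* m) :* (m :* (a :* (w :* (w :* (w :* (w :* con 1)))))) :+ a :* (m :* w) :+ b) refl ω a b (- 1#) ⟩
      (- 1# * - 1#) * (- 1# * (a * ω ^ 4)) + a * (- 1# * ω) + b
                                       ≈⟨ +-congʳ (+-congʳ (*-cong -1*-1≈1 (*-congˡ (*-congˡ ω^4≈1)))) ⟩
      1# * (- 1# * (a * 1#)) + a * (- 1# * ω) + b
                                       ≈⟨ solve 4 (λ w a b m → con 1 :* (m :* (a :* con 1)) :+ a :* (m :* w) :+ b := b :+ m :* (a :* (con 1 :+ w))) refl ω a b (- 1#) ⟩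
      b + - 1# * (a * (1# + ω))        ≈⟨ +-congˡ (-1*x≈-x _) ⟩
      b - a * (1# + ω)                 ∎

    module _ {h a₀ a₁ : Carrier} (h≉0 : ¬ (h ≈ 0#)) (two≉0 : ¬ (two F ≈ 0#))
             (a₀-spec : a₀ * (two F * h) ≈ h * h + 1#)
             (a₁-spec : a₁ * (four F * (h * ω)) ≈ (ω + 1#) * (h * h - 1#)) where

      -- (1 + ω)² = 2ω because ω² = -1.
      a₁[1+ω]*2h≈h²-1 : a₁ * (1# + ω) * (two F * h) ≈ h * h - 1#
      a₁[1+ω]*2h≈h²-1 = *-cancelʳ-≉0 (two F * ω) (*-≉0 two≉0 ω≉0) (begin
        a₁ * (1# + ω) * (two F * h) * (two F * ω)
          ≈⟨ solve 4 (λ a w h k → a :* (con 1 :+ w) :* ((con 1 :+ con 1) :* h) :* ((con 1 :+ con 1) :* w) := a :* (((con 1 :+ con 1) :+ (con 1 :+ con 1)) :* (h :* w)) :* (con 1 :+ w)) refl a₁ ω h (h * h - 1#) ⟩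
        a₁ * (four F * (h * ω)) * (1# + ω)
          ≈⟨ *-congʳ a₁-spec ⟩
        (ω + 1#) * (h * h - 1#) * (1# + ω)
          ≈⟨ solve 2 (λ w k → (w :+ con 1) :* k :* (con 1 :+ w) := k :* (w :* w :+ con 1) :+ k :* ((con 1 :+ con 1) :* w)) refl ω (h * h - 1#) ⟩
        (h * h - 1#) * (ω * ω + 1#) + (h * h - 1#) * (two F * ω)
          ≈⟨ +-congʳ (trans (*-congˡ (trans (+-congʳ ω²≈-1) (-‿inverseˡ 1#))) (zeroʳ _)) ⟩
        0# + (h * h - 1#) * (two F * ω)
          ≈⟨ +-identityˡ _ ⟩
        (h * h - 1#) * (two F * ω) ∎)

      a₀+a₁[1+ω]≈h : a₀ + a₁ * (1# + ω) ≈ h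
      a₀+a₁[1+ω]≈h = *-cancelʳ-≉0 (two F * h) (*-≉0 two≉0 h≉0) (begin
        (a₀ + a₁ * (1# + ω)) * (two F * h)
          ≈⟨ distribʳ _ a₀ _ ⟩
        a₀ * (two F * h) + a₁ * (1# + ω) * (two F * h)
          ≈⟨ +-cong a₀-spec a₁[1+ω]*2h≈h²-1 ⟩
        (h * h + 1#) + (h * h - 1#)
          ≈⟨ solve 2 (λ h m → (h :* h :+ con 1) :+ (h :* h :+ m) := h :* ((con 1 :+ con 1) :* h) :+ (con 1 :+ m)) refl h (- 1#) ⟩
        h * (two F * h) + (1# - 1#)
          ≈⟨ trans (+-congˡ (-‿inverseʳ 1#)) (+-identityʳ _) ⟩
        h * (two F * h) ∎)

      a₀-a₁[1+ω]≈h⁻¹ : a₀ - a₁ * (1# + ω) ≈ h ⁻¹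
      a₀-a₁[1+ω]≈h⁻¹ = *-cancelʳ-≉0 (two F * h) (*-≉0 two≉0 h≉0) (begin
        (a₀ - a₁ * (1# + ω)) * (two F * h)
          ≈⟨ *-congʳ (+-congˡ (-x≈-1*x _)) ⟩
        (a₀ + - 1# * (a₁ * (1# + ω))) * (two F * h)
          ≈⟨ solve 4 (λ a₀ m t h → (a₀ :+ m :* t) :* ((con 1 :+ con 1) :* h) := a₀ :* ((con 1 :+ con 1) :* h) :+ m :* (t :* ((con 1 :+ con 1) :* h))) refl a₀ (- 1#) (a₁ * (1# + ω)) h ⟩
        a₀ * (two F * h) + - 1# * (a₁ * (1# + ω) * (two F * h))
          ≈⟨ +-cong a₀-spec (*-congˡ a₁[1+ω]*2h≈h²-1) ⟩
        (h * h + 1#) + - 1# * (h * h - 1#)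
          ≈⟨ solve 2 (λ h m → (h :* h :+ con 1) :+ m :* (h :* h :+ m) := (h :* h) :* (con 1 :+ m) :+ (con 1 :+ m :* m)) refl h (- 1#) ⟩
        (h * h) * (1# - 1#) + (1# + - 1# * - 1#)
          ≈⟨ +-cong (trans (*-congˡ (-‿inverseʳ 1#)) (zeroʳ _)) (+-congˡ -1*-1≈1) ⟩
        0# + two F
          ≈⟨ trans (+-identityˡ _) (sym (*-identityʳ _)) ⟩
        two F * 1#
          ≈⟨ *-congˡ (sym (inverseʳ h h≉0)) ⟩
        two F * (h * h ⁻¹)
          ≈⟨ solve 3 (λ t h v → t :* (h :* v) := v :* (t :* h)) refl (two F) h (h ⁻¹) ⟩
        h ⁻¹ * (two F * h) ∎)

  module InvolutionCriterion
      (d : ℕ) (^d-FourthRoot : ∀ x → ¬ (x ≈ 0#) → FourthRoot (x ^ d))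
      {h h⁻ : Carrier} (h*h⁻≈1 : h * h⁻ ≈ 1#) (h^d≈-1 : h ^ d ≈ - 1#)
      (f : Carrier → Carrier)
      (f-zero : ∀ x → x ≈ 0# → f x ≈ 0#)
      (f-Root⁺ : ∀ x → Root⁺ (x ^ d) → f x ≈ h * x)
      (f-Root⁻ : ∀ x → Root⁻ (x ^ d) → f x ≈ h⁻ * x)
    where
    h⁻^d≈-1 : h⁻ ^ d ≈ - 1#
    h⁻^d≈-1 = begin
      h⁻ ^ d                        ≈⟨ sym (*-identityʳ _) ⟩
      h⁻ ^ d * 1#                   ≈⟨ *-congˡ (sym -1*-1≈1) ⟩
      h⁻ ^ d * (- 1# * - 1#)        ≈⟨ sym (*-assoc _ _ _) ⟩
      (h⁻ ^ d * - 1#) * - 1#        ≈⟨ *-congʳ (*-congˡ (sym h^d≈-1)) ⟩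
      (h⁻ ^ d * h ^ d) * - 1#       ≈⟨ *-congʳ (sym (^-distrib-* h⁻ h d)) ⟩
      (h⁻ * h) ^ d * - 1#           ≈⟨ *-congʳ (trans (^-congˡ d (trans (*-comm h⁻ h) h*h⁻≈1)) (1^n≈1 d)) ⟩
      1# * - 1#                     ≈⟨ *-identityˡ _ ⟩
      - 1#                          ∎

    ^d-scale : ∀ {v} → v ^ d ≈ - 1# → ∀ {x y} → y ≈ v * x → y ^ d ≈ - (x ^ d)
    ^d-scale {v} v^d≈-1 {x} {y} y≈vx = begin
      y ^ d           ≈⟨ ^-congˡ d y≈vx ⟩
      (v * x) ^ d     ≈⟨ ^-distrib-* v x d ⟩
      v ^ d * x ^ d   ≈⟨ *-congʳ v^d≈-1 ⟩
      - 1# * x ^ d    ≈⟨ -1*x≈-x _ ⟩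
      - (x ^ d)       ∎

    involutive : ∀ x → f (f x) ≈ x
    involutive x with x ≟ 0#
    ... | yes x≈0 = trans (f-zero (f x) (f-zero x x≈0)) (sym x≈0)
    ... | no x≉0 with ^d-FourthRoot x x≉0
    ...   | inj₁ r⁺ = begin
            f (f x)        ≈⟨ f-Root⁻ (f x) (Root⁻-resp (sym (^d-scale h^d≈-1 fx≈hx)) (-‿Root⁺ r⁺)) ⟩
            h⁻ * f x       ≈⟨ *-congˡ fx≈hx ⟩
            h⁻ * (h * x)   ≈⟨ x*y≈1⇒x*[y*z]≈z (trans (*-comm h⁻ h) h*h⁻≈1) x ⟩
            x              ∎
      where
      fx≈hx : f x ≈ h * x
      fx≈hx = f-Root⁺ x r⁺
    ...   | inj₂ r⁻ = begin
            f (f x)        ≈⟨ f-Root⁺ (f x) (Root⁺-resp (sym (^d-scale h⁻^d≈-1 fx≈h⁻x)) (-‿Root⁻ r⁻)) ⟩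
            h * f x        ≈⟨ *-congˡ fx≈h⁻x ⟩
            h * (h⁻ * x)   ≈⟨ x*y≈1⇒x*[y*z]≈z h*h⁻≈1 x ⟩
            x              ∎
      where
      fx≈h⁻x : f x ≈ h⁻ * x
      fx≈h⁻x = f-Root⁻ x r⁻

    fixed⇒≈0 : ¬ (h ≈ 1#) → ∀ x → f x ≈ x → x ≈ 0#
    fixed⇒≈0 h≉1 x fx≈x with x ≟ 0#
    ... | yes x≈0 = x≈0
    ... | no x≉0 with ^d-FourthRoot x x≉0
    ...   | inj₁ r⁺ = contradiction (x*y≈y⇒x≈1 x≉0 (trans (sym (f-Root⁺ x r⁺)) fx≈x)) h≉1
    ...   | inj₂ r⁻ = contradiction (trans (sym (*-identityʳ h)) (trans (*-congˡ (sym h⁻≈1)) h*h⁻≈1)) h≉1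
      where
      h⁻≈1 : h⁻ ≈ 1#
      h⁻≈1 = x*y≈y⇒x≈1 x≉0 (trans (sym (f-Root⁻ x r⁻)) fx≈x)

module Generator {c ℓ n} (F : FiniteField c ℓ (N.suc n))
                 (g : FiniteField.Carrier F) (gen : IsGenerator F g) where
  open FiniteField F
  open FieldProperties F
  open import Relation.Binary.Reasoning.Setoid setoid
  open import Algebra.Properties.Semiring.Exp semiring using (^-congˡ; ^-congʳ; ^-homo-*; ^-assocʳ)

  g≉0 : ¬ (g ≈ 0#)
  g≉0 = proj₁ gen

  log : ∀ x → ¬ (x ≈ 0#) → ℕ
  log x x≉0 = proj₁ (proj₂ gen x x≉0)

  g^log : ∀ x (x≉0 : ¬ (x ≈ 0#)) → g ^ log x x≉0 ≈ x
  g^log x x≉0 = proj₂ (proj₂ gen x x≉0)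

  ^-%-period : ∀ M .{{_ : N.NonZero M}} → g ^ M ≈ 1# → ∀ k → g ^ k ≈ g ^ (k % M)
  ^-%-period M g^M≈1 k = begin
    g ^ k                               ≈⟨ ^-congʳ g (m≡m%n+[m/n]*n k M) ⟩
    g ^ (k % M N.+ (k / M) N.* M)       ≈⟨ ^-homo-* g (k % M) _ ⟩
    g ^ (k % M) * g ^ ((k / M) N.* M)   ≈⟨ *-congˡ (^-congʳ g (ℕ.*-comm (k / M) M)) ⟩
    g ^ (k % M) * g ^ (M N.* (k / M))   ≈⟨ *-congˡ (sym (^-assocʳ g M (k / M))) ⟩
    g ^ (k % M) * (g ^ M) ^ (k / M)     ≈⟨ *-congˡ (trans (^-congˡ (k / M) g^M≈1) (1^n≈1 (k / M))) ⟩
    g ^ (k % M) * 1#                    ≈⟨ *-identityʳ _ ⟩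
    g ^ (k % M)                         ∎

  -- Sending 0 to 0 and g^k to 1 + (k mod M) injects F into Fin (1 + M).
  period-≥ : ∀ M → 0 N.< M → g ^ M ≈ 1# → n N.≤ M
  period-≥ M@(N.suc _) _ g^M≈1 = ℕ.≤-pred (injective⇒≤ {f = index} index-injective)
    where
    index′ : ∀ x → Dec (x ≈ 0#) → Fin (N.suc M)
    index′ x (yes _)  = Fin.zero
    index′ x (no x≉0) = Fin.suc (fromℕ< (m%n<n (log x x≉0) M))
    index : Fin (N.suc n) → Fin (N.suc M)
    index j = index′ (enum j) (enum j ≟ 0#)
    index′-injective : ∀ {x y} dx dy → index′ x dx ≡.≡ index′ y dy → x ≈ y
    index′-injective (yes x≈0) (yes y≈0) _ = trans x≈0 (sym y≈0)
    index′-injective (yes _)   (no _)    ()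
    index′-injective (no _)    (yes _)   ()
    index′-injective {x} {y} (no x≉0) (no y≉0) eq = begin
      x                    ≈⟨ sym (g^log x x≉0) ⟩
      g ^ log x x≉0        ≈⟨ ^-%-period M g^M≈1 (log x x≉0) ⟩
      g ^ (log x x≉0 % M)  ≡⟨ ≡.cong (g ^_) log%≡ ⟩
      g ^ (log y y≉0 % M)  ≈⟨ sym (^-%-period M g^M≈1 (log y y≉0)) ⟩
      g ^ log y y≉0        ≈⟨ g^log y y≉0 ⟩
      y                    ∎
      where
      log%≡ : log x x≉0 % M ≡.≡ log y y≉0 % M
      log%≡ = ≡.trans (≡.sym (toℕ-fromℕ< _)) (≡.trans (≡.cong toℕ (suc-injective eq)) (toℕ-fromℕ< _))
    index-injective : ∀ {i j} → index i ≡.≡ index j → i ≡.≡ j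
    index-injective {i} {j} eq = enum-injective i j (index′-injective _ _ eq)

  g^k≉1 : ∀ {k} → 0 N.< k → k N.< n → ¬ (g ^ k ≈ 1#)
  g^k≉1 0<k k<n g^k≈1 = ℕ.<⇒≱ k<n (period-≥ _ 0<k g^k≈1)

  collision⇒g^n≈1 : ∀ {a b} → a N.< b → b N.≤ n → g ^ a ≈ g ^ b → g ^ n ≈ 1#
  collision⇒g^n≈1 {a} {b} a<b b≤n g^a≈g^b = trans (^-congʳ g (≡.sym b∸a≡n)) g^[b∸a]≈1
    where
    g^[b∸a]≈1 : g ^ (b ∸ a) ≈ 1#
    g^[b∸a]≈1 = *-cancelʳ-≉0 (g ^ a) (^-≉0 g≉0 a) (begin
      g ^ (b ∸ a) * g ^ a      ≈⟨ *-comm _ _ ⟩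
      g ^ a * g ^ (b ∸ a)      ≈⟨ sym (^-homo-* g a (b ∸ a)) ⟩
      g ^ (a N.+ (b ∸ a))      ≡⟨ ≡.cong (g ^_) (ℕ.m+[n∸m]≡n (ℕ.<⇒≤ a<b)) ⟩
      g ^ b                    ≈⟨ sym g^a≈g^b ⟩
      g ^ a                    ≈⟨ sym (*-identityˡ _) ⟩
      1# * g ^ a               ∎)
    b∸a≡n : b ∸ a ≡.≡ n
    b∸a≡n = ℕ.≤-antisym (ℕ.≤-trans (ℕ.m∸n≤m b a) b≤n) (period-≥ (b ∸ a) (ℕ.m<n⇒0<n∸m a<b) g^[b∸a]≈1)

  -- Pigeonhole: the n + 1 powers g^0, …, g^n land in the n nonzero elements.
  g^n≈1 : g ^ n ≈ 1#
  g^n≈1 = from-collision (pigeonhole (ℕ.n<1+n n) (λ k → punchOut (index₀≢power k)))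
    where
    index₀ : Fin (N.suc n)
    index₀ = proj₁ (enum-surjective 0#)
    power : Fin (N.suc n) → Fin (N.suc n)
    power k = proj₁ (enum-surjective (g ^ toℕ k))
    enum-power : ∀ k → enum (power k) ≈ g ^ toℕ k
    enum-power k = proj₂ (enum-surjective (g ^ toℕ k))
    index₀≢power : ∀ k → index₀ ≡.≢ power k
    index₀≢power k index₀≡power = ^-≉0 g≉0 (toℕ k) (begin
      g ^ toℕ k      ≈⟨ sym (enum-power k) ⟩
      enum (power k) ≡⟨ ≡.cong enum index₀≡power ⟨
      enum index₀    ≈⟨ proj₂ (enum-surjective 0#) ⟩
      0#             ∎)
    from-collision : (∃₂ λ a b → a Fin.< b × punchOut (index₀≢power a) ≡.≡ punchOut (index₀≢power b)) → g ^ n ≈ 1#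
    from-collision (a , b , a<b , eq) = collision⇒g^n≈1 a<b (ℕ.≤-pred (toℕ<n b)) (begin
      g ^ toℕ a           ≈⟨ sym (enum-power a) ⟩
      enum (power a)      ≡⟨ ≡.cong enum (punchOut-injective (index₀≢power a) (index₀≢power b) eq) ⟩
      enum (power b)      ≈⟨ enum-power b ⟩
      g ^ toℕ b           ∎)

module InvolutionPolynomial
    {c ℓ n} (F : FiniteField c ℓ (N.suc n)) ([1+n]%4≡1 : N.suc n % 4 ≡ 1)
    (g : FiniteField.Carrier F) (gen : IsGenerator F g)
    (i : ℕ) (i<d : i < dOf F)
  where
  open FiniteField F
  open FieldProperties F
  open Generator F g gen
  open import Relation.Binary.Reasoning.Setoid setoid
  open import Algebra.Properties.Semiring.Exp semiring using (^-congˡ; ^-congʳ; ^-homo-*; ^-assocʳ)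
  open import Algebra.Solver.Ring.NaturalCoefficients.Default commutativeSemiring
    using (solve; _:=_; _:+_; _:*_; con)

  d : ℕ
  d = dOf F

  n≡d*4 : n ≡ d N.* 4
  n≡d*4 = [1+n]%4≡1⇒n≡n/4*4 n [1+n]%4≡1

  0<d : 0 N.< d
  0<d = ℕ.≤-<-trans N.z≤n i<d

  ω : Carrier
  ω = g ^ d

  ω²≉1 : ¬ (ω * ω ≈ 1#)
  ω²≉1 ω²≈1 = g^k≉1 0<2d 2d<n (begin
      g ^ (d N.* 2)    ≈⟨ ^-assocʳ g d 2 ⟨
      ω * (ω * 1#)     ≈⟨ *-congˡ (*-identityʳ ω) ⟩
      ω * ω            ≈⟨ ω²≈1 ⟩
      1#               ∎)
    where
    0<2d : 0 N.< d N.* 2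
    0<2d = ℕ.<-≤-trans 0<d (ℕ.m≤m*n d 2)
    2d<n : d N.* 2 N.< n
    2d<n = ≡.subst (d N.* 2 N.<_) (≡.sym n≡d*4) (ℕ.*-monoʳ-< d {{N.>-nonZero 0<d}} (N.s<s (N.s<s N.z<s)))

  ω²≈-1 : ω * ω ≈ - 1#
  ω²≈-1 = x*x≈1⇒x≈-1 ω⁴≈1 ω²≉1
    where
    ω⁴≈1 : (ω * ω) * (ω * ω) ≈ 1#
    ω⁴≈1 = begin
      (ω * ω) * (ω * ω)   ≈⟨ solve 1 (λ w → (w :* w) :* (w :* w) := w :* (w :* (w :* (w :* con 1)))) refl ω ⟩
      (g ^ d) ^ 4         ≈⟨ ^-assocʳ g d 4 ⟩
      g ^ (d N.* 4)       ≡⟨ ≡.cong (g ^_) n≡d*4 ⟨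
      g ^ n               ≈⟨ g^n≈1 ⟩
      1#                  ∎

  open FourthRoots F ω

  ^d-FourthRoot : ∀ x → ¬ (x ≈ 0#) → FourthRoot (x ^ d)
  ^d-FourthRoot x x≉0 = FourthRoot-resp (begin
    ω ^ log x x≉0        ≈⟨ ^-comm-^ g d (log x x≉0) ⟩
    (g ^ log x x≉0) ^ d  ≈⟨ ^-congˡ d (g^log x x≉0) ⟩
    x ^ d                ∎) (ω^-FourthRoot ω²≈-1 (log x x≉0))

  e : ℕ
  e = 4 N.* i N.+ 2

  h : Carrier
  h = g ^ e

  h≉0 : ¬ (h ≈ 0#)
  h≉0 = ^-≉0 g≉0 e

  h≉1 : ¬ (h ≈ 1#)
  h≉1 = g^k≉1 (ℕ.<-≤-trans N.z<s (ℕ.m≤n+m 2 (4 N.* i))) (≡.subst (e N.<_) (≡.sym n≡d*4) (4i+2<d*4 i<d))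

  h^d≈-1 : h ^ d ≈ - 1#
  h^d≈-1 = trans (^-comm-^ g e d) (ω^[4j+2]≈-1 ω²≈-1 i)

  two≉0 : ¬ (two F ≈ 0#)
  two≉0 = -1≉1⇒two≉0 (λ -1≈1 → ω²≉1 (trans ω²≈-1 -1≈1))

  g^[2e]≈h*h : g ^ (2 N.* e) ≈ h * h
  g^[2e]≈h*h = begin
    g ^ (2 N.* e)   ≡⟨ ≡.cong (g ^_) (ℕ.*-comm 2 e) ⟩
    g ^ (e N.* 2)   ≈⟨ ^-assocʳ g e 2 ⟨
    h * (h * 1#)    ≈⟨ *-congˡ (*-identityʳ h) ⟩
    h * h           ∎

  g^[4i+d+2]≈h*ω : g ^ (4 N.* i N.+ d N.+ 2) ≈ h * ω
  g^[4i+d+2]≈h*ω = trans (^-congʳ g (xy∙z≈xz∙y (4 N.* i) d 2)) (^-homo-* g e d)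

  a₀-spec : a₀ F g i * (two F * h) ≈ h * h + 1#
  a₀-spec = trans (÷-*-cancel _ (*-≉0 two≉0 h≉0)) (+-congʳ g^[2e]≈h*h)

  a₁-spec : a₁ F g i * (four F * (h * ω)) ≈ (ω + 1#) * (h * h - 1#)
  a₁-spec = begin
    a₁ F g i * (four F * (h * ω))                       ≈⟨ *-congˡ (*-congˡ g^[4i+d+2]≈h*ω) ⟨
    a₁ F g i * (four F * g ^ (4 N.* i N.+ d N.+ 2))     ≈⟨ ÷-*-cancel _ (*-≉0 (two≉0⇒four≉0 two≉0) (^-≉0 g≉0 (4 N.* i N.+ d N.+ 2))) ⟩
    (ω + 1#) * (g ^ (2 N.* e) - 1#)                     ≈⟨ *-congˡ (+-congʳ g^[2e]≈h*h) ⟩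
    (ω + 1#) * (h * h - 1#)                             ∎

  f : Carrier → Carrier
  f = invPoly F g i

  f≈cubic : ∀ x → f x ≈ cubic (a₁ F g i) (a₀ F g i) (x ^ d) * x
  f≈cubic x = begin
    (ω * a₁ F g i) * x ^ (3 N.* d N.+ 1) + a₁ F g i * x ^ (d N.+ 1) + a₀ F g i * x
      ≈⟨ +-congʳ (+-cong (*-congˡ x^[3d+1]) (*-congˡ (^-+1 x d))) ⟩
    (ω * a₁ F g i) * ((x ^ d) ^ 3 * x) + a₁ F g i * (x ^ d * x) + a₀ F g i * x
      ≈⟨ solve 5 (λ w a b u x → (w :* a) :* ((u :* (u :* (u :* con 1))) :* x) :+ a :* (u :* x) :+ b :* x := ((w :* a) :* (u :* (u :* u)) :+ a :* u :+ b) :* x) refl ω (a₁ F g i) (a₀ F g i) (x ^ d) x ⟩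
    cubic (a₁ F g i) (a₀ F g i) (x ^ d) * x
      ∎
    where
    ^-+1 : ∀ y m → y ^ (m N.+ 1) ≈ y ^ m * y
    ^-+1 y m = trans (^-homo-* y m 1) (*-congˡ (*-identityʳ y))
    x^[3d+1] : x ^ (3 N.* d N.+ 1) ≈ (x ^ d) ^ 3 * x
    x^[3d+1] = trans (^-+1 x (3 N.* d)) (*-congʳ (trans (^-congʳ x (ℕ.*-comm 3 d)) (sym (^-assocʳ x d 3))))

  f-zero : ∀ x → x ≈ 0# → f x ≈ 0#
  f-zero x x≈0 = trans (f≈cubic x) (trans (*-congˡ x≈0) (zeroʳ _))

  f≈h*x : ∀ x → Root⁺ (x ^ d) → f x ≈ h * x
  f≈h*x x r = trans (f≈cubic x) (*-congʳ (trans (cubic-Root⁺ ω²≈-1 _ _ r)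
                (a₀+a₁[1+ω]≈h ω²≈-1 h≉0 two≉0 a₀-spec a₁-spec)))

  f≈h⁻¹*x : ∀ x → Root⁻ (x ^ d) → f x ≈ h ⁻¹ * x
  f≈h⁻¹*x x r = trans (f≈cubic x) (*-congʳ (trans (cubic-Root⁻ ω²≈-1 _ _ r)
                  (a₀-a₁[1+ω]≈h⁻¹ ω²≈-1 h≉0 two≉0 a₀-spec a₁-spec)))

  open InvolutionCriterion d ^d-FourthRoot (inverseʳ h h≉0) h^d≈-1 f f-zero f≈h*x f≈h⁻¹*x public

theorem1 : ∀ {c ℓ : Level} (q : ℕ) (F : FiniteField c ℓ q) → q % 4 ≡ 1 →
           (g : FiniteField.Carrier F) → IsGenerator F g →
           (i : ℕ) → i < (q ∸ 1) / 4 →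
           let open FiniteField F
               f = invPoly F g i
           in (∀ x → f (f x) ≈ x) × (f 0# ≈ 0#) × (∀ x → f x ≈ x → x ≈ 0#)
theorem1 N.zero F () g gen i i<d
theorem1 (N.suc n) F [1+n]%4≡1 g gen i i<d =
  involutive , f-zero 0# refl , fixed⇒≈0 h≉1
  where
  open FiniteField F using (0#; refl)
  open InvolutionPolynomial F [1+n]%4≡1 g gen i i<d
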